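{- Let $L=(S,A,\to)$ be a labelled transition system and $x,y\in\{o,b\}$. Then $\underline{\leftrightarrow}_{(x,y)}$ satisfies the stuttering property: whenever $t_0\xrightarrow{\tau}t_1\xrightarrow{\tau}\cdots\xrightarrow{\tau}t_k$ with $t_0\,\underline{\leftrightarrow}_{(x,y)}\,t_k$, then $t_i\,\underline{\leftrightarrow}_{(x,y)}\,t_j$ for all $0\le i,j\le k$.
   Context: LTS $L=(S,A,\to)$: states $S$, actions $A$ containing the internal action $\tau$, $\to\subseteq S\times A\times S$ written $s\xrightarrow{a}t$; $\twoheadrightarrow$ is the reflexive-transitive closure of $\xrightarrow{\tau}$. For $R\subseteq S\times S$ and $s,s',t\in S$: $s\twoheadrightarrow_{o,R,t}s'$ iff $s\twoheadrightarrow s'$; $s\twoheadrightarrow_{b,R,t}s'$ iff $s\twoheadrightarrow s'$, $t\,R\,s$ and $t\,R\,s'$. For $x,y\in\{o,b\}$ a symmetric relation $R\subseteq S\times S$ is an $(x,y)$-generic bisimulation if whenever $s\,R\,t$ and $s\xrightarrow{a}s'$, either $a=\tau$ and $s'\,R\,t$, or there exist $t_1,t_2,t'$ with $t\twoheadrightarrow_{x,R,s}t_1\xrightarrow{a}t_2\twoheadrightarrow_{y,R,s'}t'$ and $s'\,R\,t'$. $s\,\underline{\leftrightarrow}_{(x,y)}\,t$ iff some $(x,y)$-generic bisimulation relates $s$ and $t$. -}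

module Defs where

open import Level using (Level; suc; _⊔_)
open import Data.Nat using (ℕ)
open import Data.Fin using (Fin; inject₁; toℕ) renaming (suc to fsuc)
open import Data.Product using (Σ; ∃; _×_; _,_)
open import Data.Sum using (_⊎_)
open import Relation.Binary.PropositionalEquality using (_≡_)
open import Relation.Binary.Construct.Closure.ReflexiveTransitive using (Star)

record LTS : Set₁ where
  field
    S    : Set
    A    : Set
    τ    : A
    _⟶[_]_ : S → A → S → Set

data Kind : Set where
  o b : Kind

module _ (L : LTS) where
  open LTS L

  τstep : S → S → Set
  τstep s t = s ⟶[ τ ] t

  _↠_ : S → S → Set
  s ↠ t = Star τstep s t

  ↠[_] : Kind → (S → S → Set) → S → S → S → Set
  ↠[ o ] R t s s' = s ↠ s'
  ↠[ b ] R t s s' = (s ↠ s') × R t s × R t s'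

  Symmetric : (S → S → Set) → Set
  Symmetric R = ∀ {s t} → R s t → R t s

  IsGenericBisim : Kind → Kind → (S → S → Set) → Set
  IsGenericBisim x y R =
    Symmetric R ×
    (∀ {s t s' a} → R s t → s ⟶[ a ] s' →
       ((a ≡ τ) × R s' t)
       ⊎ Σ S λ t₁ → Σ S λ t₂ → Σ S λ t' →
           ↠[ x ] R s t t₁ × t₁ ⟶[ a ] t₂ × ↠[ y ] R s' t₂ t' × R s' t')

  GenBisimilar : Kind → Kind → S → S → Set₁
  GenBisimilar x y s t = Σ (S → S → Set) λ R → IsGenericBisim x y R × R s t

  IsτPath : (k : ℕ) → (Fin (ℕ.suc k) → S) → Set
  IsτPath k t = (i : Fin k) → t (inject₁ i) ⟶[ τ ] t (fsuc i)

-- Given a bisimulation B with s B v and a silent path s ↠ r ↠ v, the relation obtained from B by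
-- adding the identity and every pair (s, r) of this shape, together with the reversed pairs, is
-- again an (x,y)-generic bisimulation; so every state on a silent path between two bisimilar
-- states is bisimilar to its source. On a τ-path t₀ ↠ tₖ with t₀ ↔ tₖ, simulating t₀ ↠ tᵢ from tₖ
-- yields v with tₖ ↠ v and tᵢ ↔ v, and for i ≤ j the state tⱼ lies on the silent path tᵢ ↠ tₖ ↠ v.
module Submission where

open import Defs
open import Data.Nat using (ℕ; suc; z≤n; s≤s)
open import Data.Fin using (Fin; fromℕ; zero; _≤_) renaming (suc to fsuc)
open import Data.Fin.Properties using (≤fromℕ; ≤-total)
open import Data.Product using (Σ; _×_; _,_; proj₁; proj₂)
open import Data.Sum using (_⊎_; inj₁; inj₂; [_,_]′)
open import Function using (_∘_)
open import Relation.Binary.PropositionalEquality using (_≡_; refl)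
open import Relation.Binary.Construct.Closure.ReflexiveTransitive using (ε; _◅_; _◅◅_)

module _ (L : LTS) where
  open LTS L

  ↠-unsnoc : ∀ {r v} → _↠_ L r v → r ≡ v ⊎ Σ S λ p → _↠_ L r p × p ⟶[ τ ] v
  ↠-unsnoc ε = inj₁ refl
  ↠-unsnoc (r⟶r₁ ◅ r₁↠v) with ↠-unsnoc r₁↠v
  ... | inj₁ refl = inj₂ (_ , ε , r⟶r₁)
  ... | inj₂ (p , r₁↠p , p⟶v) = inj₂ (p , r⟶r₁ ◅ r₁↠p , p⟶v)

  τPath-↠ : ∀ k {t : Fin (suc k) → S} → IsτPath L k t → ∀ {i j} → i ≤ j → _↠_ L (t i) (t j)
  τPath-↠ ℕ.zero _ {zero} {zero} _ = ε
  τPath-↠ (suc k) _ {zero} {zero} _ = ε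
  τPath-↠ (suc k) path {zero} {fsuc j} _ = path zero ◅ τPath-↠ k (path ∘ fsuc) {zero} {j} z≤n
  τPath-↠ (suc k) path {fsuc i} {fsuc j} (s≤s i≤j) = τPath-↠ k (path ∘ fsuc) {i} {j} i≤j

  module _ {R : S → S → Set} where

    ↠[]-path : ∀ k {t s s'} → ↠[_] L k R t s s' → _↠_ L s s'
    ↠[]-path o s↠s' = s↠s'
    ↠[]-path b (s↠s' , _ , _) = s↠s'

    ↠[]-intro : ∀ k {t s s'} → _↠_ L s s' → R t s → R t s' → ↠[_] L k R t s s'
    ↠[]-intro o s↠s' _ _ = s↠s'
    ↠[]-intro b s↠s' tRs tRs' = s↠s' , tRs , tRs'

    ↠[]-refl : ∀ k {t s} → R t s → ↠[_] L k R t s s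
    ↠[]-refl k tRs = ↠[]-intro k ε tRs tRs

    ↠[]-prepend : ∀ k {t s₀ s s'} → R t s₀ → _↠_ L s₀ s → ↠[_] L k R t s s' → ↠[_] L k R t s₀ s'
    ↠[]-prepend o _ s₀↠s s↠s' = s₀↠s ◅◅ s↠s'
    ↠[]-prepend b tRs₀ s₀↠s (s↠s' , _ , tRs') = s₀↠s ◅◅ s↠s' , tRs₀ , tRs'

    ↠[]-map : ∀ k {Q : S → S → Set} → (∀ {u v} → R u v → Q u v) →
              ∀ {t s s'} → ↠[_] L k R t s s' → ↠[_] L k Q t s s'
    ↠[]-map o _ s↠s' = s↠s'
    ↠[]-map b R⊆Q (s↠s' , tRs , tRs') = s↠s' , R⊆Q tRs , R⊆Q tRs'

  module _ (x y : Kind) where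

    Transfer : (S → S → Set) → S → S → A → S → Set
    Transfer R s t a s' =
      ((a ≡ τ) × R s' t)
      ⊎ Σ S λ t₁ → Σ S λ t₂ → Σ S λ t' →
          ↠[_] L x R s t t₁ × t₁ ⟶[ a ] t₂ × ↠[_] L y R s' t₂ t' × R s' t'

    transfer-mono : ∀ {R Q : S → S → Set} → (∀ {u v} → R u v → Q u v) →
                    ∀ {s t a s'} → Transfer R s t a s' → Transfer Q s t a s'
    transfer-mono R⊆Q (inj₁ (a≡τ , s'Rt)) = inj₁ (a≡τ , R⊆Q s'Rt)
    transfer-mono R⊆Q (inj₂ (t₁ , t₂ , t' , t↠t₁ , t₁⟶t₂ , t₂↠t' , s'Rt')) =
      inj₂ (t₁ , t₂ , t' , ↠[]-map x R⊆Q t↠t₁ , t₁⟶t₂ , ↠[]-map y R⊆Q t₂↠t' , R⊆Q s'Rt')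

    module _ {B : S → S → Set} (B-bisim : IsGenericBisim L x y B) where

      private
        B-sym : Symmetric L B
        B-sym = proj₁ B-bisim

        B-transfer : ∀ {s t s' a} → B s t → s ⟶[ a ] s' → Transfer B s t a s'
        B-transfer = proj₂ B-bisim

      simulate-↠ : ∀ {s v s'} → B s v → _↠_ L s s' → Σ S λ v' → _↠_ L v v' × B s' v'
      simulate-↠ {v = v} sBv ε = v , ε , sBv
      simulate-↠ sBv (s⟶s₁ ◅ s₁↠s') with B-transfer sBv s⟶s₁
      ... | inj₁ (_ , s₁Bv) = simulate-↠ s₁Bv s₁↠s'
      ... | inj₂ (_ , _ , v₁ , v↠w₁ , w₁⟶w₂ , w₂↠v₁ , s₁Bv₁) with simulate-↠ s₁Bv₁ s₁↠s'
      ...   | v' , v₁↠v' , s'Bv' =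
                v' , (↠[]-path x v↠w₁ ◅◅ w₁⟶w₂ ◅ ↠[]-path y w₂↠v₁) ◅◅ v₁↠v' , s'Bv'

      data Stutter : S → S → Set where
        same     : ∀ {s} → Stutter s s
        base     : ∀ {s t} → B s t → Stutter s t
        stutter  : ∀ {s r v} → _↠_ L s r → _↠_ L r v → B s v → Stutter s r
        stutter⁻ : ∀ {s r v} → _↠_ L s r → _↠_ L r v → B s v → Stutter r s

      Stutter-sym : Symmetric L Stutter
      Stutter-sym same = same
      Stutter-sym (base sBt) = base (B-sym sBt)
      Stutter-sym (stutter s↠r r↠v sBv) = stutter⁻ s↠r r↠v sBv
      Stutter-sym (stutter⁻ s↠r r↠v sBv) = stutter s↠r r↠v sBv

      private
        copy-move : ∀ {s t a s'} → _↠_ L t s → Stutter s t → s ⟶[ a ] s' → Transfer Stutter s t a s'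
        copy-move t↠s sSt s⟶s' = inj₂ (_ , _ , _ , ↠[]-intro x t↠s sSt same , s⟶s' , ↠[]-refl y same , same)

        -- When B matches s ⟶τ s' by stuttering (s' B v), r answers with the last τ-step p ⟶τ v
        -- of r ↠ v; its source p still lies on the silent path s ↠ p ↠ v.
        stutter-move : ∀ {s r v a s'} → _↠_ L s r → _↠_ L r v → B s v →
                       s ⟶[ a ] s' → Transfer Stutter s r a s'
        stutter-move {v = v} s↠r r↠v sBv s⟶s' with B-transfer sBv s⟶s'
        ... | inj₂ (v₁ , v₂ , v' , v↠v₁ , v₁⟶v₂ , v₂↠v' , s'Bv') =
          inj₂ (v₁ , v₂ , v' , ↠[]-prepend x (stutter s↠r r↠v sBv) r↠v (↠[]-map x base v↠v₁)
               , v₁⟶v₂ , ↠[]-map y base v₂↠v' , base s'Bv')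
        ... | inj₁ (refl , s'Bv) with ↠-unsnoc r↠v
        ...   | inj₁ refl = inj₁ (refl , base s'Bv)
        ...   | inj₂ (p , r↠p , p⟶v) =
          inj₂ (p , v , v , ↠[]-intro x r↠p (stutter s↠r r↠v sBv) (stutter (s↠r ◅◅ r↠p) (p⟶v ◅ ε) sBv)
               , p⟶v , ↠[]-refl y (base s'Bv) , base s'Bv)

      Stutter-transfer : ∀ {s t s' a} → Stutter s t → s ⟶[ a ] s' → Transfer Stutter s t a s'
      Stutter-transfer same = copy-move ε same
      Stutter-transfer (base sBt) = transfer-mono base ∘ B-transfer sBt
      Stutter-transfer (stutter s↠r r↠v sBv) = stutter-move s↠r r↠v sBv
      Stutter-transfer (stutter⁻ s↠r r↠v sBv) = copy-move s↠r (stutter⁻ s↠r r↠v sBv)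

      Stutter-isGenericBisim : IsGenericBisim L x y Stutter
      Stutter-isGenericBisim = Stutter-sym , Stutter-transfer

    ↔-sym : ∀ {s t} → GenBisimilar L x y s t → GenBisimilar L x y t s
    ↔-sym (R , R-bisim@(R-sym , _) , sRt) = R , R-bisim , R-sym sRt

    ↔-simulate-↠ : ∀ {s v s'} → GenBisimilar L x y s v → _↠_ L s s' →
                   Σ S λ v' → _↠_ L v v' × GenBisimilar L x y s' v'
    ↔-simulate-↠ (R , R-bisim , sRv) s↠s' with simulate-↠ R-bisim sRv s↠s'
    ... | v' , v↠v' , s'Rv' = v' , v↠v' , (R , R-bisim , s'Rv')

    ↔-stutter : ∀ {s r v} → GenBisimilar L x y s v → _↠_ L s r → _↠_ L r v → GenBisimilar L x y s r
    ↔-stutter (R , R-bisim , sRv) s↠r r↠v =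
      Stutter R-bisim , Stutter-isGenericBisim R-bisim , stutter s↠r r↠v sRv

lemma4p8 : (L : LTS) (x y : Kind) (k : ℕ) (t : Fin (suc k) → LTS.S L) →
           IsτPath L k t →
           GenBisimilar L x y (t zero) (t (fromℕ k)) →
           (i j : Fin (suc k)) → GenBisimilar L x y (t i) (t j)
lemma4p8 L x y k t path t₀↔tₖ i j = [ forward , ↔-sym L x y ∘ forward ]′ (≤-total i j)
  where
    forward : ∀ {i j} → i ≤ j → GenBisimilar L x y (t i) (t j)
    forward {i} {j} i≤j with ↔-simulate-↠ L x y t₀↔tₖ (τPath-↠ L k path {zero} {i} z≤n)
    ... | v , tₖ↠v , tᵢ↔v =
      ↔-stutter L x y tᵢ↔v (τPath-↠ L k path i≤j) (τPath-↠ L k path (≤fromℕ j) ◅◅ tₖ↠v)
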